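{- Let $\mathcal{F}=\langle X,Y,\le_X,\le_Y,R,T\rangle$ and $\hat{\mathcal{F}}=\langle \hat X,\hat Y,\le_{\hat X},\le_{\hat Y},\hat R,\hat T\rangle$ be FI-frames and $(g,h)\colon\mathcal{F}\to\hat{\mathcal{F}}$ a FI-morphism. Then $(g,h)$ is an isomorphism in the category $\mathsf{FIFram}$ if and only if $g$ and $h$ are isomorphisms of posets.
   Context: A FI-frame is a structure $\langle X,Y,\le_X,\le_Y,R,T\rangle$ where $\langle X,\le_X\rangle,\langle Y,\le_Y\rangle$ are posets, $R\subseteq X\times Y\times X$ and $T\subseteq Y\times X\times X$ satisfy: if $(x,y,z)\in R$, $\bar x\le_X x$, $\bar y\le_Y y$, $z\le_X\bar z$ then $(\bar x,\bar y,\bar z)\in R$; if $(y,x,z)\in T$, $\bar y\le_Y y$, $\bar x\le_X x$, $z\le_X\bar z$ then $(\bar y,\bar x,\bar z)\in T$. A FI-morphism $(g,h)\colon\mathcal{F}\to\hat{\mathcal{F}}$ is a pair of monotone maps $g\colon X\to\hat X$, $h\colon Y\to\hat Y$ such that: (M1) $(x,y,z)\in R$ implies $(g(x),h(y),g(z))\in\hat R$; (M2) if $(\bar x,\bar y,g(z))\in\hat R$ then there exist $x\in X$, $y\in Y$ with $(x,y,z)\in R$, $\bar x\le_{\hat X}g(x)$, $\bar y\le_{\hat Y}h(y)$; (N1) $(x,y,z)\in T$ implies $(h(x),g(y),g(z))\in\hat T$; (N2) if $(\bar x,g(y),\bar z)\in\hat T$ then there exist $x\in Y$, $z\in X$ with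 $(x,y,z)\in T$, $\bar x\le_{\hat Y}h(x)$, $g(z)\le_{\hat X}\bar z$. $\mathsf{FIFram}$ is the category of FI-frames and FI-morphisms, with componentwise composition and identities $(id_X,id_Y)$. -}

module Defs where

open import Data.Product using (Σ; ∃; _×_; _,_)
open import Relation.Binary.PropositionalEquality using (_≡_)
open import Relation.Binary.Structures using (IsPartialOrder)

record Pos : Set₁ where
  field
    Carrier : Set
    _≤_     : Carrier → Carrier → Set
    isPO    : IsPartialOrder _≡_ _≤_

open Pos public using (Carrier)

Monotone : (P Q : Pos) → (Carrier P → Carrier Q) → Set
Monotone P Q f = ∀ {a b} → Pos._≤_ P a b → Pos._≤_ Q (f a) (f b)

record FIFrame : Set₁ where
  field
    X : Pos
    Y : Pos
    R : Carrier X → Carrier Y → Carrier X → Set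
    T : Carrier Y → Carrier X → Carrier X → Set
    R-closed : ∀ {x y z x̄ ȳ z̄} → R x y z → Pos._≤_ X x̄ x → Pos._≤_ Y ȳ y →
               Pos._≤_ X z z̄ → R x̄ ȳ z̄
    T-closed : ∀ {y x z ȳ x̄ z̄} → T y x z → Pos._≤_ Y ȳ y → Pos._≤_ X x̄ x →
               Pos._≤_ X z z̄ → T ȳ x̄ z̄

record IsFIMorphism (F F̂ : FIFrame)
    (g : Carrier (FIFrame.X F) → Carrier (FIFrame.X F̂))
    (h : Carrier (FIFrame.Y F) → Carrier (FIFrame.Y F̂)) : Set where
  open FIFrame F
  private
    module F̂ = FIFrame F̂
    _≤X̂_ = Pos._≤_ F̂.X
    _≤Ŷ_ = Pos._≤_ F̂.Y
  field
    g-mono : Monotone X F̂.X g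
    h-mono : Monotone Y F̂.Y h
    M1 : ∀ {x y z} → R x y z → F̂.R (g x) (h y) (g z)
    M2 : ∀ {x̄ ȳ z} → F̂.R x̄ ȳ (g z) →
         Σ (Carrier X) λ x → Σ (Carrier Y) λ y →
           R x y z × (x̄ ≤X̂ g x) × (ȳ ≤Ŷ h y)
    N1 : ∀ {x y z} → T x y z → F̂.T (h x) (g y) (g z)
    N2 : ∀ {x̄ y z̄} → F̂.T x̄ (g y) z̄ →
         Σ (Carrier Y) λ x → Σ (Carrier X) λ z →
           T x y z × (x̄ ≤Ŷ h x) × (g z ≤X̂ z̄)

IsFIIso : (F F̂ : FIFrame)
    (g : Carrier (FIFrame.X F) → Carrier (FIFrame.X F̂))
    (h : Carrier (FIFrame.Y F) → Carrier (FIFrame.Y F̂)) → Set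
IsFIIso F F̂ g h =
  Σ (Carrier (FIFrame.X F̂) → Carrier (FIFrame.X F)) λ g' →
  Σ (Carrier (FIFrame.Y F̂) → Carrier (FIFrame.Y F)) λ h' →
    IsFIMorphism F̂ F g' h' ×
    (∀ x → g' (g x) ≡ x) × (∀ x̂ → g (g' x̂) ≡ x̂) ×
    (∀ y → h' (h y) ≡ y) × (∀ ŷ → h (h' ŷ) ≡ ŷ)

IsPosetIso : (P Q : Pos) → (Carrier P → Carrier Q) → Set
IsPosetIso P Q f =
  Monotone P Q f ×
  Σ (Carrier Q → Carrier P) λ f' →
    Monotone Q P f' × (∀ a → f' (f a) ≡ a) × (∀ b → f (f' b) ≡ b)

module Submission where

open import Defs
open import Data.Product using (_×_; _,_)
open import Function.Bundles using (_⇔_; mk⇔)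
open import Relation.Binary.PropositionalEquality using (_≡_; sym; subst)
open import Relation.Binary.Structures using (IsPartialOrder)

module PO (P : Pos) = IsPartialOrder (Pos.isPO P)

module _ (P Q : Pos) {f : Carrier P → Carrier Q} {f⁻¹ : Carrier Q → Carrier P}
         (f⁻¹-mono : Monotone Q P f⁻¹) (f⁻¹∘f≗id : ∀ a → f⁻¹ (f a) ≡ a) where

  ≤-image⇒inverse-≤ : ∀ {b a} → Pos._≤_ Q b (f a) → Pos._≤_ P (f⁻¹ b) a
  ≤-image⇒inverse-≤ b≤fa = PO.trans P (f⁻¹-mono b≤fa) (PO.reflexive P (f⁻¹∘f≗id _))

  image-≤⇒≤-inverse : ∀ {a b} → Pos._≤_ Q (f a) b → Pos._≤_ P a (f⁻¹ b)
  image-≤⇒≤-inverse fa≤b = PO.trans P (PO.reflexive P (sym (f⁻¹∘f≗id _))) (f⁻¹-mono fa≤b)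

-- Conditions M2 and N2 supply exactly the witnesses needed for M1 and N1 of the
-- inverse, and M1, N1 conversely give M2, N2 of the inverse with the images as witnesses.
module _ {F F̂ : FIFrame}
         {g : Carrier (FIFrame.X F) → Carrier (FIFrame.X F̂)}
         {h : Carrier (FIFrame.Y F) → Carrier (FIFrame.Y F̂)}
         (m : IsFIMorphism F F̂ g h)
         {g⁻¹ : Carrier (FIFrame.X F̂) → Carrier (FIFrame.X F)}
         {h⁻¹ : Carrier (FIFrame.Y F̂) → Carrier (FIFrame.Y F)}
         (g⁻¹-mono : Monotone (FIFrame.X F̂) (FIFrame.X F) g⁻¹)
         (h⁻¹-mono : Monotone (FIFrame.Y F̂) (FIFrame.Y F) h⁻¹)
         (g⁻¹∘g≗id : ∀ x → g⁻¹ (g x) ≡ x)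
         (g∘g⁻¹≗id : ∀ x̂ → g (g⁻¹ x̂) ≡ x̂)
         (h⁻¹∘h≗id : ∀ y → h⁻¹ (h y) ≡ y) where
  open FIFrame F
  private module F̂ = FIFrame F̂
  open IsFIMorphism m

  inverse-isFIMorphism : IsFIMorphism F̂ F g⁻¹ h⁻¹
  IsFIMorphism.g-mono inverse-isFIMorphism = g⁻¹-mono
  IsFIMorphism.h-mono inverse-isFIMorphism = h⁻¹-mono
  IsFIMorphism.M1 inverse-isFIMorphism {x} {y} {z} r =
    let x₀ , y₀ , r₀ , x≤gx₀ , y≤hy₀ = M2 (subst (F̂.R x y) (sym (g∘g⁻¹≗id z)) r)
    in R-closed r₀ (≤-image⇒inverse-≤ X F̂.X g⁻¹-mono g⁻¹∘g≗id x≤gx₀)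
                   (≤-image⇒inverse-≤ Y F̂.Y h⁻¹-mono h⁻¹∘h≗id y≤hy₀)
                   (PO.refl X)
  IsFIMorphism.M2 inverse-isFIMorphism {x} {y} {ẑ} r =
    g x , h y , subst (F̂.R (g x) (h y)) (g∘g⁻¹≗id ẑ) (M1 r) ,
    PO.reflexive X (sym (g⁻¹∘g≗id x)) , PO.reflexive Y (sym (h⁻¹∘h≗id y))
  IsFIMorphism.N1 inverse-isFIMorphism {x} {y} {z} t =
    let x₀ , z₀ , t₀ , x≤hx₀ , gz₀≤z = N2 (subst (λ w → F̂.T x w z) (sym (g∘g⁻¹≗id y)) t)
    in T-closed t₀ (≤-image⇒inverse-≤ Y F̂.Y h⁻¹-mono h⁻¹∘h≗id x≤hx₀)
                   (PO.refl X)
                   (image-≤⇒≤-inverse X F̂.X g⁻¹-mono g⁻¹∘g≗id gz₀≤z)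
  IsFIMorphism.N2 inverse-isFIMorphism {x} {y} {z} t =
    h x , g z , subst (λ w → F̂.T (h x) w (g z)) (g∘g⁻¹≗id y) (N1 t) ,
    PO.reflexive Y (sym (h⁻¹∘h≗id x)) , PO.reflexive X (g⁻¹∘g≗id z)

lemma4p7 : (F F̂ : FIFrame)
    (g : Carrier (FIFrame.X F) → Carrier (FIFrame.X F̂))
    (h : Carrier (FIFrame.Y F) → Carrier (FIFrame.Y F̂)) →
    IsFIMorphism F F̂ g h →
    (IsFIIso F F̂ g h ⇔
      (IsPosetIso (FIFrame.X F) (FIFrame.X F̂) g × IsPosetIso (FIFrame.Y F) (FIFrame.Y F̂) h))
lemma4p7 F F̂ g h m = mk⇔ isFIIso⇒isPosetIsos isPosetIsos⇒isFIIso
  where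
  open IsFIMorphism m using (g-mono; h-mono)

  isFIIso⇒isPosetIsos : IsFIIso F F̂ g h →
    IsPosetIso (FIFrame.X F) (FIFrame.X F̂) g × IsPosetIso (FIFrame.Y F) (FIFrame.Y F̂) h
  isFIIso⇒isPosetIsos (g⁻¹ , h⁻¹ , m⁻¹ , g⁻¹∘g , g∘g⁻¹ , h⁻¹∘h , h∘h⁻¹) =
    (g-mono , g⁻¹ , IsFIMorphism.g-mono m⁻¹ , g⁻¹∘g , g∘g⁻¹) ,
    (h-mono , h⁻¹ , IsFIMorphism.h-mono m⁻¹ , h⁻¹∘h , h∘h⁻¹)

  isPosetIsos⇒isFIIso :
    IsPosetIso (FIFrame.X F) (FIFrame.X F̂) g × IsPosetIso (FIFrame.Y F) (FIFrame.Y F̂) h →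
    IsFIIso F F̂ g h
  isPosetIsos⇒isFIIso ((_ , g⁻¹ , g⁻¹-mono , g⁻¹∘g , g∘g⁻¹) ,
                       (_ , h⁻¹ , h⁻¹-mono , h⁻¹∘h , h∘h⁻¹)) =
    g⁻¹ , h⁻¹ , inverse-isFIMorphism m g⁻¹-mono h⁻¹-mono g⁻¹∘g g∘g⁻¹ h⁻¹∘h ,
    g⁻¹∘g , g∘g⁻¹ , h⁻¹∘h , h∘h⁻¹
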